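{- Let $r\ge 2$ and let $n$ be a positive integer. Define $n^*=\chi(H_{n:r})+n$. Then \[\chi(H_{n:r})\le \chi(H_{n^*:r+1}).\]
   Context: For positive integers $n,r$ write $[n]=\{1,\dots,n\}$. The Häggkvist–Hell graph $H_{n:r}$ is the graph whose vertices are the ordered pairs $(h,T)$ where $T$ is an $r$-element subset of $[n]$ and $h\in[n]\setminus T$; two vertices $(h_x,T_x)$ and $(h_y,T_y)$ are adjacent iff $h_x\in T_y$, $h_y\in T_x$ and $T_x\cap T_y=\varnothing$. $\chi$ denotes chromatic number. -}

module Defs where

open import Data.Nat using (ℕ; _<_)
open import Data.Fin using (Fin)
open import Data.Fin.Subset using (Subset; _∈_; _∉_; _∩_; ⊥; ∣_∣)
open import Data.Product using (Σ; _×_; _,_; proj₁)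
open import Relation.Binary.PropositionalEquality using (_≡_; _≢_)
open import Relation.Nullary using (¬_)

record HHVertex (n r : ℕ) : Set where
  constructor hhv
  field
    head  : Fin n
    tail  : Subset n
    size  : ∣ tail ∣ ≡ r
    head∉ : head ∉ tail
open HHVertex public

HHAdj : ∀ {n r} → HHVertex n r → HHVertex n r → Set
HHAdj x y = (head x ∈ tail y) × (head y ∈ tail x) × (tail x ∩ tail y ≡ ⊥)

ProperColouring : (n r k : ℕ) → Set
ProperColouring n r k =
  Σ (HHVertex n r → Fin k) λ c →
    ∀ x y → HHAdj x y → c x ≢ c y

IsChromaticNumberHH : (n r k : ℕ) → Set
IsChromaticNumberHH n r k =
  ProperColouring n r k × (∀ m → m < k → ¬ ProperColouring n r m)

module Submission where

-- A proper colouring c : H_{n:r} → [k] induces a graph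
-- homomorphism H_{n:r} → H_{k+n:r+1}: relabel the ground set [k+n] as the
-- k "colour points" followed by a copy of [n], and send (h , T) to
-- (h , {c(h,T)} ∪ T).  Adjacent vertices stay adjacent, because their new
-- tails only add the two distinct colour points c x ≠ c y.  Pulling back
-- colourings along a homomorphism shows that χ is monotone under
-- homomorphisms; applied to an optimal colouring (k = χ(H_{n:r})) this
-- gives χ(H_{n:r}) ≤ χ(H_{n*:r+1}) with n* = χ(H_{n:r}) + n.

open import Defs
open import Data.Nat using (ℕ; zero; suc; _+_; _≤_)
open import Data.Nat.Properties using (≮⇒≥)
open import Data.Bool using (true; false; _∧_)
open import Data.Fin using (Fin; _↑ʳ_)
open import Data.Fin.Subset using (Subset; _∈_; _∩_; ⊥; ∣_∣; ⁅_⁆)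
open import Data.Fin.Subset.Properties
  using (∣⁅x⁆∣≡1; x∈⁅y⁆⇒x≡y; x∈p∩q⁻; Empty-unique)
open import Data.Vec using ([]; _∷_; _++_; replicate)
open import Data.Vec.Properties
  using (zipWith-++; lookup-++ʳ; []=⇒lookup; lookup⇒[]=)
open import Data.Product using (Σ; _,_)
open import Relation.Binary.PropositionalEquality
  using (_≡_; _≢_; refl; sym; trans; cong; cong₂; module ≡-Reasoning)

∣++∣ : ∀ {m k} (u : Subset m) (v : Subset k) → ∣ u ++ v ∣ ≡ ∣ u ∣ + ∣ v ∣
∣++∣ []          v = refl
∣++∣ (true ∷ u)  v = cong suc (∣++∣ u v)
∣++∣ (false ∷ u) v = ∣++∣ u v

∈-++ʳ⁺ : ∀ {m k} (u : Subset m) {v : Subset k} {x : Fin k} →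
         x ∈ v → (m ↑ʳ x) ∈ (u ++ v)
∈-++ʳ⁺ u {v} {x} x∈v = lookup⇒[]= _ (u ++ v) (trans (lookup-++ʳ u v x) ([]=⇒lookup x∈v))

∈-++ʳ⁻ : ∀ {m k} (u : Subset m) {v : Subset k} {x : Fin k} →
         (m ↑ʳ x) ∈ (u ++ v) → x ∈ v
∈-++ʳ⁻ u {v} {x} x∈uv = lookup⇒[]= x v (trans (sym (lookup-++ʳ u v x)) ([]=⇒lookup x∈uv))

replicate-++ : ∀ {A : Set} m {k} (a : A) →
               replicate m a ++ replicate k a ≡ replicate (m + k) a
replicate-++ zero    a = refl
replicate-++ (suc m) a = cong (a ∷_) (replicate-++ m a)

++-disjoint : ∀ {m k} {u u' : Subset m} {v v' : Subset k} →
              u ∩ u' ≡ ⊥ → v ∩ v' ≡ ⊥ → (u ++ v) ∩ (u' ++ v') ≡ ⊥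
++-disjoint {m} {k} {u} {u'} {v} {v'} uu'≡⊥ vv'≡⊥ = begin
  (u ++ v) ∩ (u' ++ v')   ≡⟨ zipWith-++ _∧_ u v u' v' ⟩
  (u ∩ u') ++ (v ∩ v')    ≡⟨ cong₂ _++_ uu'≡⊥ vv'≡⊥ ⟩
  ⊥ {m} ++ ⊥ {k}          ≡⟨ replicate-++ m false ⟩
  ⊥                       ∎
  where open ≡-Reasoning

⁅⁆-disjoint : ∀ {m} {a b : Fin m} → a ≢ b → ⁅ a ⁆ ∩ ⁅ b ⁆ ≡ ⊥
⁅⁆-disjoint {a = a} {b} a≢b = Empty-unique λ where
  (z , z∈ab) → let (z∈a , z∈b) = x∈p∩q⁻ ⁅ a ⁆ ⁅ b ⁆ z∈ab
               in a≢b (trans (sym (x∈⁅y⁆⇒x≡y a z∈a)) (x∈⁅y⁆⇒x≡y b z∈b))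

HHHom : (n r n' r' : ℕ) → Set
HHHom n r n' r' =
  Σ (HHVertex n r → HHVertex n' r') λ f → ∀ x y → HHAdj x y → HHAdj (f x) (f y)

pullback : ∀ {n r n' r' k} → HHHom n r n' r' →
           ProperColouring n' r' k → ProperColouring n r k
pullback (f , f-adj) (c , c-proper) =
  (λ x → c (f x)) , λ x y x~y → c-proper (f x) (f y) (f-adj x y x~y)

χ-monotone : ∀ {n r n' r' χ χ'} → HHHom n r n' r' →
             IsChromaticNumberHH n r χ → IsChromaticNumberHH n' r' χ' → χ ≤ χ'
χ-monotone hom (_ , χ-minimal) (colouring' , _) =
  ≮⇒≥ λ χ'<χ → χ-minimal _ χ'<χ (pullback hom colouring')

colourExtension : ∀ {n r k} → ProperColouring n r k → HHHom n r (k + n) (suc r)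
colourExtension {n} {r} {k} (c , c-proper) = extend , extend-adj
  where
  extendTail : HHVertex n r → Subset (k + n)
  extendTail x = ⁅ c x ⁆ ++ tail x

  extend : HHVertex n r → HHVertex (k + n) (suc r)
  extend x = hhv (k ↑ʳ head x) (extendTail x)
    (trans (∣++∣ ⁅ c x ⁆ (tail x)) (cong₂ _+_ (∣⁅x⁆∣≡1 (c x)) (size x)))
    (λ h∈ → head∉ x (∈-++ʳ⁻ ⁅ c x ⁆ h∈))

  extend-adj : ∀ x y → HHAdj x y → HHAdj (extend x) (extend y)
  extend-adj x y x~y@(hx∈Ty , hy∈Tx , Tx∩Ty≡⊥) =
    ∈-++ʳ⁺ ⁅ c y ⁆ hx∈Ty ,
    ∈-++ʳ⁺ ⁅ c x ⁆ hy∈Tx ,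
    ++-disjoint (⁅⁆-disjoint (c-proper x y x~y)) Tx∩Ty≡⊥

mainTheorem18 : (r n : ℕ) → 2 ≤ r → 1 ≤ n →
    (χ₁ : ℕ) → IsChromaticNumberHH n r χ₁ →
    (χ₂ : ℕ) → IsChromaticNumberHH (χ₁ + n) (suc r) χ₂ →
    χ₁ ≤ χ₂
mainTheorem18 r n _ _ χ₁ χ₁-isχ@(optimalColouring , _) χ₂ χ₂-isχ =
  χ-monotone (colourExtension optimalColouring) χ₁-isχ χ₂-isχ
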